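{- Let $(\Psi_d)_d$ be a constraint structure with both a meet operation $\wedge$ and a lift, let $(\preceq,\wedge,P)$ be decent, and let $(\mathcal R^d)_d$ be a constraint-refining predicate that relates to a constraint-producing predicate $(\models^d)_d$ (axioms A1, A2). If $\vdash^{d}\Gamma\to\sigma'$ is derivable in DI, then for all $\sigma\in\Psi_d$ such that $P(\sigma\wedge\sigma')$, there exists $\sigma''\in\Psi_d$ such that $\sigma''\equiv\sigma\wedge\sigma'$ and $\sigma\to\vdash^{d}\Gamma\to\sigma''$ is derivable in SDI.
   Context: Formulae: first-order, negation normal form (literals, $\wedge,\vee,\forall,\exists$). There are eigenvariables ($\bar x$) and meta-variables ($X$). Domains: initial domain $d_0$; $d;\bar x$ (resp. $d;X$) extends $d$ by a fresh eigenvariable (meta-variable). Terms/formulae of domain $d$ have (free) variables among those declared in $d$. A context of domain $d$ is a multiset of formulae of domain $d$; $\Gamma_{lit}$ is its set of literals. A constraint structure: sets $(\Psi_d)_d$ with $\Psi_{d;\bar x}=\Psi_d$ and projections $\Psi_{d;X}\to\Psi_d$, $\sigma\mapsto\sigma{\downarrow}$; here also a binary operation $\wedge$ on each $\Psi_d$ and lift maps $\Psi_d\to\Psi_{d;X}$, $\sigma\mapsto\sigma{\uparrow}$. Decency: $\preceq$ is a family of preorders on the $\Psi_d$, $\equiv$ the equivalence generated by $\preceq$, $P$ a family of predicates; $(\preceq,\wedge,P)$ is decent if (D1) $\sigma\wedge\sigma'$ is a greatest lower bound of $\sigma,\sigma'$ for $\preceq$; (D2) for $\sigma\in\Psi_d$,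 $\sigma',\sigma''\in\Psi_{d;X}$: $\sigma''\equiv\sigma{\uparrow}\wedge\sigma'\Rightarrow\sigma''{\downarrow}\equiv\sigma\wedge\sigma'{\downarrow}$; (P1) for $\sigma\in\Psi_{d;X}$, $P(\sigma)\Leftrightarrow P(\sigma{\downarrow})$; (P2) $P(\sigma)$ and $\sigma\preceq\sigma'$ imply $P(\sigma')$. A constraint-producing predicate: relations $\mathcal A\models^d\sigma$ ($\mathcal A$ a set of literals of domain $d$, $\sigma\in\Psi_d$). A constraint-refining predicate: relations $\mathcal R^d(\sigma,\mathcal A,\sigma')$ with $\sigma,\sigma'\in\Psi_d$. It relates to $(\models^d)_d$ if for all $d,\mathcal A,\sigma\in\Psi_d$: (A1) for all $\sigma'$, $\mathcal R^d(\sigma,\mathcal A,\sigma')$ implies there is $\sigma''\in\Psi_d$ with $\sigma'\equiv\sigma\wedge\sigma''$, $P(\sigma\wedge\sigma'')$ and $\mathcal A\models^d\sigma''$; (A2) for all $\sigma'$, if $P(\sigma\wedge\sigma')$ and $\mathcal A\models^d\sigma'$ then there is $\sigma''$ with $\sigma''\equiv\sigma\wedge\sigma'$ and $\mathcal R^d(\sigma,\mathcal A,\sigma'')$. DI rules (sequents $\vdash^d\Gamma\to\sigma$): $\vdash^d\Gamma\to\sigma$ if $\Gamma_{lit}\models^d\sigma$; from $\vdash^d\Gamma,A\to\sigma$ and $\vdash^d\Gamma,B\to\sigma'$ infer $\vdash^d\Gamma,A\wedge B\to\sigma\wedge\sigma'$; from $\vdash^d\Gamma,A,B\to\sigma$ infer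 $\vdash^d\Gamma,A\vee B\to\sigma$; from $\vdash^{d;X}\Gamma,A[x:=X],\exists xA\to\sigma$ infer $\vdash^d\Gamma,\exists xA\to\sigma{\downarrow}$ ($X$ fresh); from $\vdash^{d;\bar x}\Gamma,A[x:=\bar x]\to\sigma$ infer $\vdash^d\Gamma,\forall xA\to\sigma$ ($\bar x$ fresh). SDI rules (sequents $\sigma\to\vdash^d\Gamma\to\sigma'$): $\sigma\to\vdash^d\Gamma\to\sigma'$ if $\mathcal R^d(\sigma,\Gamma_{lit},\sigma')$; from $\sigma\to\vdash^d\Gamma,A,B\to\sigma'$ infer $\sigma\to\vdash^d\Gamma,A\vee B\to\sigma'$; for $i\in\{0,1\}$, from $\sigma\to\vdash^d\Gamma,A_i\to\sigma''$ and $\sigma''\to\vdash^d\Gamma,A_{1-i}\to\sigma'$ infer $\sigma\to\vdash^d\Gamma,A_0\wedge A_1\to\sigma'$; from $\sigma{\uparrow}\to\vdash^{d;X}\Gamma,A[x:=X],\exists xA\to\sigma'$ infer $\sigma\to\vdash^d\Gamma,\exists xA\to\sigma'{\downarrow}$ ($X$ fresh); from $\sigma\to\vdash^{d;\bar x}\Gamma,A[x:=\bar x]\to\sigma'$ infer $\sigma\to\vdash^d\Gamma,\forall xA\to\sigma'$ ($\bar x$ fresh). -}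

module Defs where

open import Data.Nat using (ℕ)
open import Data.Empty using (⊥)
open import Data.Maybe using (Maybe; just; nothing)
open import Data.Vec using (Vec; []; _∷_)
open import Data.List using (List; []; _∷_)
open import Data.Product using (Σ; _×_; _,_)
open import Data.List.Relation.Binary.Permutation.Propositional using (_↭_)

-- Domains: d₀, d;x̄ (fresh eigenvariable), d;X (fresh meta-variable)

data Dom : Set where
  d₀  : Dom
  _▸ē : Dom → Dom
  _▸M : Dom → Dom

-- variables declared in a domain (the newest one is `nothing`)
Var : Dom → Set
Var d₀       = ⊥
Var (d ▸ē)   = Maybe (Var d)
Var (d ▸M)   = Maybe (Var d)

-- Ψ_{d;x̄} = Ψ_d : constraint sets only depend on the domain with its
-- trailing eigenvariables removed.
norm : Dom → Dom
norm d₀       = d₀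
norm (d ▸ē)   = norm d
norm (d ▸M)   = d ▸M

record Signature : Set₁ where
  field
    Fun       : Set
    funArity  : Fun → ℕ
    Pred      : Set
    predArity : Pred → ℕ

module Syntax (S : Signature) where
  open Signature S

  data Term (V : Set) : Set where
    var : V → Term V
    app : (f : Fun) → Vec (Term V) (funArity f) → Term V

  mutual
    mapT : ∀ {V W : Set} → (V → W) → Term V → Term W
    mapT ρ (var x)    = var (ρ x)
    mapT ρ (app f ts) = app f (mapTs ρ ts)

    mapTs : ∀ {V W : Set} {n} → (V → W) → Vec (Term V) n → Vec (Term W) n
    mapTs ρ []       = []
    mapTs ρ (t ∷ ts) = mapT ρ t ∷ mapTs ρ ts

  data Lit (V : Set) : Set where
    pos : (p : Pred) → Vec (Term V) (predArity p) → Lit V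
    neg : (p : Pred) → Vec (Term V) (predArity p) → Lit V

  -- formulae; a binder binds `nothing` in the body
  data Form (V : Set) : Set where
    lit      : Lit V → Form V
    _∧'_ _∨'_ : Form V → Form V → Form V
    ∀' ∃'    : Form (Maybe V) → Form V

  mapL : ∀ {V W : Set} → (V → W) → Lit V → Lit W
  mapL ρ (pos p ts) = pos p (mapTs ρ ts)
  mapL ρ (neg p ts) = neg p (mapTs ρ ts)

  liftR : ∀ {V W : Set} → (V → W) → Maybe V → Maybe W
  liftR ρ nothing  = nothing
  liftR ρ (just x) = just (ρ x)

  mapF : ∀ {V W : Set} → (V → W) → Form V → Form W
  mapF ρ (lit l)   = lit (mapL ρ l)
  mapF ρ (A ∧' B)  = mapF ρ A ∧' mapF ρ B
  mapF ρ (A ∨' B)  = mapF ρ A ∨' mapF ρ B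
  mapF ρ (∀' A)    = ∀' (mapF (liftR ρ) A)
  mapF ρ (∃' A)    = ∃' (mapF (liftR ρ) A)

  -- formulae / contexts (multisets, as lists up to permutation) of domain d
  Formula : Dom → Set
  Formula d = Form (Var d)

  Ctx : Dom → Set
  Ctx d = List (Formula d)

  wkF : ∀ {V : Set} → Form V → Form (Maybe V)
  wkF = mapF just

  wkCtx : ∀ {V : Set} → List (Form V) → List (Form (Maybe V))
  wkCtx []       = []
  wkCtx (A ∷ Γ)  = wkF A ∷ wkCtx Γ

  -- A[x := new variable]: since Var (d;x̄) = Var (d;X) = Maybe (Var d)
  -- and the bound variable is `nothing`, the instance is A itself.
  instE : ∀ {d} → Form (Maybe (Var d)) → Formula (d ▸ē)
  instE A = mapF (λ x → x) A

  instM : ∀ {d} → Form (Maybe (Var d)) → Formula (d ▸M)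
  instM A = mapF (λ x → x) A

  lits : ∀ {V : Set} → List (Form V) → List (Lit V)
  lits []            = []
  lits (lit l ∷ Γ)   = l ∷ lits Γ
  lits (_ ∧' _ ∷ Γ)  = lits Γ
  lits (_ ∨' _ ∷ Γ)  = lits Γ
  lits (∀' _ ∷ Γ)    = lits Γ
  lits (∃' _ ∷ Γ)    = lits Γ

record ConstraintStructure : Set₁ where
  field
    Ψ₀   : Dom → Set
  -- Ψ_d (so that Ψ_{d;x̄} = Ψ_d holds definitionally)
  Ψ : Dom → Set
  Ψ d = Ψ₀ (norm d)
  field
    proj : ∀ d → Ψ (d ▸M) → Ψ d
    lift : ∀ d → Ψ d → Ψ (d ▸M)
    meet : ∀ e → Ψ₀ e → Ψ₀ e → Ψ₀ e



  meetD : ∀ d → Ψ d → Ψ d → Ψ d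
  meetD d = meet (norm d)

record OrderData (C : ConstraintStructure) : Set₁ where
  open ConstraintStructure C
  field
    le : ∀ e → Ψ₀ e → Ψ₀ e → Set
    P  : ∀ e → Ψ₀ e → Set

  leD : ∀ d → Ψ d → Ψ d → Set
  leD d = le (norm d)

  PD : ∀ d → Ψ d → Set
  PD d = P (norm d)

  eqD : ∀ d → Ψ d → Ψ d → Set
  eqD d σ σ' = leD d σ σ' × leD d σ' σ

record Decent (C : ConstraintStructure) (O : OrderData C) : Set where
  open ConstraintStructure C
  open OrderData O
  field
    ⪯-refl  : ∀ d (σ : Ψ d) → leD d σ σ
    ⪯-trans : ∀ d (σ σ' σ'' : Ψ d) → leD d σ σ' → leD d σ' σ'' → leD d σ σ''
    D1-lb₁  : ∀ d (σ σ' : Ψ d) → leD d (meetD d σ σ') σ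
    D1-lb₂  : ∀ d (σ σ' : Ψ d) → leD d (meetD d σ σ') σ'
    D1-glb  : ∀ d (σ σ' τ : Ψ d) → leD d τ σ → leD d τ σ' → leD d τ (meetD d σ σ')
    D2      : ∀ d (σ : Ψ d) (σ' σ'' : Ψ (d ▸M)) →
              eqD (d ▸M) σ'' (meetD (d ▸M) (lift d σ) σ') →
              eqD d (proj d σ'') (meetD d σ (proj d σ'))
    P1→     : ∀ d (σ : Ψ (d ▸M)) → PD (d ▸M) σ → PD d (proj d σ)
    P1←     : ∀ d (σ : Ψ (d ▸M)) → PD d (proj d σ) → PD (d ▸M) σ
    P2      : ∀ d (σ σ' : Ψ d) → PD d σ → leD d σ σ' → PD d σ'

module Predicates (S : Signature) (C : ConstraintStructure) where
  open Syntax S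
  open ConstraintStructure C

  Producing : Set₁
  Producing = ∀ d → List (Lit (Var d)) → Ψ d → Set

  Refining : Set₁
  Refining = ∀ d → Ψ d → List (Lit (Var d)) → Ψ d → Set

  record Relates (O : OrderData C) (⊨ : Producing) (ℛ : Refining) : Set where
    open OrderData O
    field
      A1 : ∀ d (𝒜 : List (Lit (Var d))) (σ σ' : Ψ d) → ℛ d σ 𝒜 σ' →
           Σ (Ψ d) λ σ'' → eqD d σ' (meetD d σ σ'') × PD d (meetD d σ σ'') × ⊨ d 𝒜 σ''
      A2 : ∀ d (𝒜 : List (Lit (Var d))) (σ σ' : Ψ d) →
           PD d (meetD d σ σ') → ⊨ d 𝒜 σ' →
           Σ (Ψ d) λ σ'' → eqD d σ'' (meetD d σ σ') × ℛ d σ 𝒜 σ''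

  -- the DI system:  ⊢^d Γ → σ   (principal formula chosen up to permutation)
  data DI (⊨ : Producing) : (d : Dom) → Ctx d → Ψ d → Set where
    ax  : ∀ {d Γ σ} → ⊨ d (lits Γ) σ → DI ⊨ d Γ σ
    ∧-r : ∀ {d Γ Δ A B σ σ'} → Δ ↭ (A ∧' B) ∷ Γ →
          DI ⊨ d (A ∷ Γ) σ → DI ⊨ d (B ∷ Γ) σ' → DI ⊨ d Δ (meetD d σ σ')
    ∨-r : ∀ {d Γ Δ A B σ} → Δ ↭ (A ∨' B) ∷ Γ →
          DI ⊨ d (A ∷ B ∷ Γ) σ → DI ⊨ d Δ σ
    ∃-r : ∀ {d Γ Δ A σ} → Δ ↭ ∃' A ∷ Γ →
          DI ⊨ (d ▸M) (instM A ∷ wkF (∃' A) ∷ wkCtx Γ) σ → DI ⊨ d Δ (proj d σ)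
    ∀-r : ∀ {d Γ Δ A σ} → Δ ↭ ∀' A ∷ Γ →
          DI ⊨ (d ▸ē) (instE A ∷ wkCtx Γ) σ → DI ⊨ d Δ σ

  data SDI (ℛ : Refining) : (d : Dom) → Ψ d → Ctx d → Ψ d → Set where
    ax   : ∀ {d Γ σ σ'} → ℛ d σ (lits Γ) σ' → SDI ℛ d σ Γ σ'
    ∨-r  : ∀ {d Γ Δ A B σ σ'} → Δ ↭ (A ∨' B) ∷ Γ →
           SDI ℛ d σ (A ∷ B ∷ Γ) σ' → SDI ℛ d σ Δ σ'
    ∧-r₀ : ∀ {d Γ Δ A B σ σ' σ''} → Δ ↭ (A ∧' B) ∷ Γ →
           SDI ℛ d σ (A ∷ Γ) σ'' → SDI ℛ d σ'' (B ∷ Γ) σ' → SDI ℛ d σ Δ σ'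
    ∧-r₁ : ∀ {d Γ Δ A B σ σ' σ''} → Δ ↭ (A ∧' B) ∷ Γ →
           SDI ℛ d σ (B ∷ Γ) σ'' → SDI ℛ d σ'' (A ∷ Γ) σ' → SDI ℛ d σ Δ σ'
    ∃-r  : ∀ {d Γ Δ A σ σ'} → Δ ↭ ∃' A ∷ Γ →
           SDI ℛ (d ▸M) (lift d σ) (instM A ∷ wkF (∃' A) ∷ wkCtx Γ) σ' →
           SDI ℛ d σ Δ (proj d σ')
    ∀-r  : ∀ {d Γ Δ A σ σ'} → Δ ↭ ∀' A ∷ Γ →
           SDI ℛ (d ▸ē) σ (instE A ∷ wkCtx Γ) σ' → SDI ℛ d σ Δ σ'

module Submission where

-- By induction on a DI derivation of  ⊢^d Γ → σ'  we build, for every σ with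
-- P(σ ∧ σ'), an SDI derivation  σ → ⊢^d Γ → σ''  with σ'' ≡ σ ∧ σ'.
--   * axiom:  this is exactly axiom (A2);
--   * ∨, ∀:   the constraints are untouched, so the induction hypothesis
--             is reused verbatim;
--   * ∧:      the two premisses are threaded sequentially: first σ through
--             the left premiss (giving τ₁ ≡ σ ∧ σ₁), then τ₁ through the
--             right one (giving τ₂ ≡ τ₁ ∧ σ₂).  The side conditions on P and
--             the final equivalence τ₂ ≡ σ ∧ (σ₁ ∧ σ₂) only use that ∧ is a
--             greatest lower bound (D1): it is monotone and associative up
--             to ≡, and P is upward closed (P2);
--   * ∃:      the meta-variable step is governed by (D2) and (P1).

open import Defs
open import Data.Product using (Σ; _×_; _,_)

module Soundness (S : Signature) (C : ConstraintStructure) (O : OrderData C)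
    (⊨ : Predicates.Producing S C) (ℛ : Predicates.Refining S C)
    (dec : Decent C O) (rel : Predicates.Relates S C O ⊨ ℛ) where
  open Syntax S
  open ConstraintStructure C
  open OrderData O
  open Decent dec
  open Predicates S C
  open Relates rel using (A2)

  module MeetOrder (d : Dom) where
    infix  4 _⪯_ _≈_
    infixr 6 _⊓_

    _⪯_ : Ψ d → Ψ d → Set
    _⪯_ = leD d

    _≈_ : Ψ d → Ψ d → Set
    _≈_ = eqD d

    _⊓_ : Ψ d → Ψ d → Ψ d
    _⊓_ = meetD d

    ⪯-trans′ : ∀ {σ σ′ σ″ : Ψ d} → σ ⪯ σ′ → σ′ ⪯ σ″ → σ ⪯ σ″
    ⪯-trans′ = ⪯-trans d _ _ _

    ≈-sym : ∀ {σ σ′ : Ψ d} → σ ≈ σ′ → σ′ ≈ σ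
    ≈-sym (le , ge) = ge , le

    ≈-trans : ∀ {σ σ′ σ″ : Ψ d} → σ ≈ σ′ → σ′ ≈ σ″ → σ ≈ σ″
    ≈-trans (le , ge) (le′ , ge′) = ⪯-trans′ le le′ , ⪯-trans′ ge′ ge

    ⊓-mono : ∀ {σ σ′ τ τ′ : Ψ d} → σ ⪯ σ′ → τ ⪯ τ′ → σ ⊓ τ ⪯ σ′ ⊓ τ′
    ⊓-mono σ⪯σ′ τ⪯τ′ =
      D1-glb d _ _ _ (⪯-trans′ (D1-lb₁ d _ _) σ⪯σ′)
                     (⪯-trans′ (D1-lb₂ d _ _) τ⪯τ′)

    ⊓-congˡ : ∀ {σ σ′ τ : Ψ d} → σ ≈ σ′ → σ ⊓ τ ≈ σ′ ⊓ τ
    ⊓-congˡ (le , ge) = ⊓-mono le (⪯-refl d _) , ⊓-mono ge (⪯-refl d _)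

    ⊓-assoc-⪯ : ∀ (σ τ υ : Ψ d) → σ ⊓ (τ ⊓ υ) ⪯ (σ ⊓ τ) ⊓ υ
    ⊓-assoc-⪯ σ τ υ =
      D1-glb d _ _ _ (⊓-mono (⪯-refl d σ) (D1-lb₁ d τ υ))
                     (⪯-trans′ (D1-lb₂ d σ _) (D1-lb₂ d τ υ))

    ⪯-⊓-assoc : ∀ (σ τ υ : Ψ d) → (σ ⊓ τ) ⊓ υ ⪯ σ ⊓ (τ ⊓ υ)
    ⪯-⊓-assoc σ τ υ =
      D1-glb d _ _ _ (⪯-trans′ (D1-lb₁ d _ υ) (D1-lb₁ d σ τ))
                     (⊓-mono (D1-lb₂ d σ τ) (⪯-refl d υ))

    ⊓-assoc : ∀ (σ τ υ : Ψ d) → (σ ⊓ τ) ⊓ υ ≈ σ ⊓ (τ ⊓ υ)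
    ⊓-assoc σ τ υ = ⪯-⊓-assoc σ τ υ , ⊓-assoc-⪯ σ τ υ

    P-resp-≈ : ∀ {σ σ′ : Ψ d} → σ ≈ σ′ → PD d σ → PD d σ′
    P-resp-≈ (le , _) p = P2 d _ _ p le

  proj-lift-meet : ∀ d (σ : Ψ d) (ρ : Ψ (d ▸M)) →
                   eqD d (proj d (meetD (d ▸M) (lift d σ) ρ)) (meetD d σ (proj d ρ))
  proj-lift-meet d σ ρ = D2 d σ ρ _ (⪯-refl (d ▸M) _ , ⪯-refl (d ▸M) _)

  P-lift-meet : ∀ d (σ : Ψ d) (ρ : Ψ (d ▸M)) →
                PD d (meetD d σ (proj d ρ)) → PD (d ▸M) (meetD (d ▸M) (lift d σ) ρ)
  P-lift-meet d σ ρ p =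
    P1← d _ (MeetOrder.P-resp-≈ d (MeetOrder.≈-sym d (proj-lift-meet d σ ρ)) p)

  Simulated : ∀ d → Ctx d → Ψ d → Ψ d → Set
  Simulated d Γ σ σ′ = Σ (Ψ d) λ σ″ → eqD d σ″ (meetD d σ σ′) × SDI ℛ d σ Γ σ″

  simulate-∧ : ∀ d {Γ₁ Γ₂ Δ : Ctx d} (σ σ₁ σ₂ : Ψ d) →
               (∀ {σ τ υ : Ψ d} → SDI ℛ d σ Γ₁ τ → SDI ℛ d τ Γ₂ υ → SDI ℛ d σ Δ υ) →
               (∀ τ → PD d (meetD d τ σ₁) → Simulated d Γ₁ τ σ₁) →
               (∀ τ → PD d (meetD d τ σ₂) → Simulated d Γ₂ τ σ₂) →
               PD d (meetD d σ (meetD d σ₁ σ₂)) → Simulated d Δ σ (meetD d σ₁ σ₂)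
  simulate-∧ d σ σ₁ σ₂ combine ih₁ ih₂ p
    with ih₁ σ (P2 d _ _ p (⊓-mono (⪯-refl d σ) (D1-lb₁ d σ₁ σ₂)))
    where open MeetOrder d
  ... | τ₁ , τ₁≈σ⊓σ₁ , sdi₁
    with ih₂ τ₁ (P-resp-≈ σ⊓[σ₁⊓σ₂]≈τ₁⊓σ₂ p)
    where
      open MeetOrder d
      σ⊓[σ₁⊓σ₂]≈τ₁⊓σ₂ : σ ⊓ (σ₁ ⊓ σ₂) ≈ τ₁ ⊓ σ₂
      σ⊓[σ₁⊓σ₂]≈τ₁⊓σ₂ = ≈-trans (≈-sym (⊓-assoc σ σ₁ σ₂)) (⊓-congˡ (≈-sym τ₁≈σ⊓σ₁))
  ... | τ₂ , τ₂≈τ₁⊓σ₂ , sdi₂ = τ₂ , τ₂≈σ⊓[σ₁⊓σ₂] , combine sdi₁ sdi₂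
    where
      open MeetOrder d
      τ₂≈σ⊓[σ₁⊓σ₂] : τ₂ ≈ σ ⊓ (σ₁ ⊓ σ₂)
      τ₂≈σ⊓[σ₁⊓σ₂] = ≈-trans τ₂≈τ₁⊓σ₂ (≈-trans (⊓-congˡ τ₁≈σ⊓σ₁) (⊓-assoc σ σ₁ σ₂))

  simulate : ∀ {d Γ σ′} → DI ⊨ d Γ σ′ → ∀ σ → PD d (meetD d σ σ′) → Simulated d Γ σ σ′
  simulate {d} {Γ} {σ′} (ax Γ⊨σ′) σ p with A2 d (lits Γ) σ σ′ p Γ⊨σ′
  ... | σ″ , σ″≈ , r = σ″ , σ″≈ , ax r
  simulate (∨-r perm D) σ p with simulate D σ p
  ... | σ″ , σ″≈ , sdi = σ″ , σ″≈ , ∨-r perm sdi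
  simulate (∀-r perm D) σ p with simulate D σ p
  ... | σ″ , σ″≈ , sdi = σ″ , σ″≈ , ∀-r perm sdi
  simulate {d} (∧-r {σ = σ₁} {σ' = σ₂} perm D₁ D₂) σ p =
    simulate-∧ d σ σ₁ σ₂ (∧-r₀ perm) (simulate D₁) (simulate D₂) p
  simulate {d} (∃-r {σ = ρ} perm D) σ p
    with simulate D (lift d σ) (P-lift-meet d σ ρ p)
  ... | τ , τ≈σ↑⊓ρ , sdi = proj d τ , D2 d σ ρ τ τ≈σ↑⊓ρ , ∃-r perm sdi

theorem3 : (S : Signature) (C : ConstraintStructure) (O : OrderData C)
    (⊨ : Predicates.Producing S C) (ℛ : Predicates.Refining S C) →
    Decent C O → Predicates.Relates S C O ⊨ ℛ →
    ∀ (d : Dom) (Γ : Syntax.Ctx S d) (σ' : ConstraintStructure.Ψ C d) →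
    Predicates.DI S C ⊨ d Γ σ' →
    ∀ (σ : ConstraintStructure.Ψ C d) →
    OrderData.PD O d (ConstraintStructure.meetD C d σ σ') →
    Σ (ConstraintStructure.Ψ C d) λ σ'' →
    OrderData.eqD O d σ'' (ConstraintStructure.meetD C d σ σ')
    × Predicates.SDI S C ℛ d σ Γ σ''
theorem3 S C O ⊨ ℛ dec rel _ _ _ D = Soundness.simulate S C O ⊨ ℛ dec rel D
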